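{- Let $G$ be a graph with $n$ vertices and $M=M[IAS(G)]$. If every $X\subseteq V(G)$ has $c_G(X)=\min\{|X|,|V(G)-X|\}$, then $\kappa(M)=n$. Otherwise, \[\kappa(M)=1+2\cdot\min\{c_G(X)\mid X\subseteq V(G),\ c_G(X)<\min\{|X|,|V(G)-X|\}\}.\]
   Context: A graph is a finite looped simple graph; $A=A(G)$ is its $GF(2)$ adjacency matrix (diagonal 1 iff looped). $M[IAS(G)]$ is the binary matroid represented by $(I\;A\;A+I)$. For a matroid on $W$ with rank $r$, $\lambda(S)=r(S)+r(W-S)-r(M)$; $S$ is a vertical $k$-separation if $\lambda(S)<k$ and $r(S),r(W-S)\ge k$; $\kappa(M)=\min(\{k\mid\text{vertical }k\text{ -separation exists}\}\cup\{r(M)\})$. The cut-rank is $c_G(X)=r(A[V(G)-X,X])$ over $GF(2)$ (empty matrix has rank 0). -}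

module Defs where

open import Data.Bool using (Bool; true; false; _∧_; _∨_; not; _xor_; if_then_else_)
open import Data.Nat using (ℕ; zero; suc; _+_; _*_; _∸_; _⊔_; _⊓_; _<ᵇ_; _≤ᵇ_)
open import Data.Fin using (Fin; splitAt; _≟_)
open import Data.Fin.Subset using (Subset; ∁; ∣_∣)
open import Data.Vec using (Vec; []; _∷_; lookup)
open import Data.List using (List; []; _∷_; map; foldr; allFin; concatMap; upTo)
open import Data.Bool.ListAction using (any; all)
open import Data.Sum using (inj₁; inj₂)
open import Relation.Binary.PropositionalEquality using (_≡_)
open import Relation.Nullary.Decidable using (⌊_⌋)

-- GF(2) = Bool with xor as addition and ∧ as multiplication.
-- A vector in GF(2)^n is a function Fin n → Bool.

GF2Vec : ℕ → Set
GF2Vec n = Fin n → Bool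

zeroVec : ∀ {n} → GF2Vec n
zeroVec _ = false

_⊕_ : ∀ {n} → GF2Vec n → GF2Vec n → GF2Vec n
(u ⊕ v) i = u i xor v i

isZeroVec : ∀ {n} → GF2Vec n → Bool
isZeroVec {n} v = all (λ i → not (v i)) (allFin n)

allSubsets : ∀ m → List (Subset m)
allSubsets zero    = [] ∷ []
allSubsets (suc m) = concatMap (λ s → (true ∷ s) ∷ (false ∷ s) ∷ []) (allSubsets m)

subsetᵇ : ∀ {m} → Subset m → Subset m → Bool
subsetᵇ {m} U T = all (λ i → not (lookup U i) ∨ lookup T i) (allFin m)

nonemptyᵇ : ∀ {m} → Subset m → Bool
nonemptyᵇ {m} U = any (λ i → lookup U i) (allFin m)

-- A binary matrix with m columns, each a vector in GF(2)^n, given as the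
-- family of its columns.  This represents a binary matroid on Fin m.

Columns : ℕ → ℕ → Set
Columns n m = Fin m → GF2Vec n

colSum : ∀ {n m} → Columns n m → Subset m → GF2Vec n
colSum {n} {m} C U = foldr (λ j acc → if lookup U j then C j ⊕ acc else acc) zeroVec (allFin m)

independentᵇ : ∀ {n m} → Columns n m → Subset m → Bool
independentᵇ {n} {m} C T =
  all (λ U → not (subsetᵇ U T ∧ nonemptyᵇ U) ∨ not (isZeroVec (colSum C U))) (allSubsets m)

rank : ∀ {n m} → Columns n m → Subset m → ℕ
rank {n} {m} C S =
  foldr (λ T acc → if subsetᵇ T S ∧ independentᵇ C T then ∣ T ∣ ⊔ acc else acc) 0 (allSubsets m)

fullSet : ∀ {m} → Subset m
fullSet {zero}  = []
fullSet {suc m} = true ∷ fullSet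

matroidRank : ∀ {n m} → Columns n m → ℕ
matroidRank C = rank C fullSet

-- connectivity function λ(S) = r(S) + r(W - S) - r(M)
-- (this is always ≥ 0 by submodularity, so truncated subtraction is exact)
connectivity : ∀ {n m} → Columns n m → Subset m → ℕ
connectivity C S = (rank C S + rank C (∁ S)) ∸ matroidRank C

verticalSepᵇ : ∀ {n m} → Columns n m → ℕ → Subset m → Bool
verticalSepᵇ C k S = (connectivity C S <ᵇ k) ∧ (k ≤ᵇ rank C S) ∧ (k ≤ᵇ rank C (∁ S))

VerticalSeparation : ∀ {n m} → Columns n m → ℕ → Subset m → Set
VerticalSeparation C k S = verticalSepᵇ C k S ≡ true

hasVerticalSepᵇ : ∀ {n m} → Columns n m → ℕ → Bool
hasVerticalSepᵇ {n} {m} C k = any (verticalSepᵇ C k) (allSubsets m)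

-- κ(M) = min ({k | a vertical k-separation exists} ∪ {r(M)}).
-- Any k admitting a vertical k-separation satisfies k ≤ r(S) ≤ r(M), so it
-- suffices to range k over 0 … r(M).
kappa : ∀ {n m} → Columns n m → ℕ
kappa C = foldr (λ k acc → if hasVerticalSepᵇ C k then k ⊓ acc else acc)
                (matroidRank C) (upTo (suc (matroidRank C)))

-- Graphs: finite looped simple graphs on vertex set Fin n, given by their
-- symmetric GF(2) adjacency matrix (diagonal entry true iff the vertex is looped).

record Graph (n : ℕ) : Set where
  field
    adj : Fin n → Fin n → Bool
    sym : ∀ u v → adj u v ≡ adj v u
open Graph public

unitVec : ∀ {n} → Fin n → GF2Vec n
unitVec i j = ⌊ i ≟ j ⌋

adjCol : ∀ {n} → Graph n → Fin n → GF2Vec n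
adjCol G i v = adj G v i

IAS : ∀ {n} → Graph n → Columns n (n + (n + n))
IAS {n} G j with splitAt n j
... | inj₁ i = unitVec i
... | inj₂ j′ with splitAt n j′
...   | inj₁ i = adjCol G i
...   | inj₂ i = adjCol G i ⊕ unitVec i

-- cut-rank c_G(X) = rank of A[V - X, X]: the columns indexed by X, each
-- restricted to the rows in V - X (rows in X are set to 0, which does not
-- change the rank).
cutRank : ∀ {n} → Graph n → Subset n → ℕ
cutRank {n} G X = rank (λ x v → not (lookup X v) ∧ adj G v x) X

module Submission where

-- Index the columns e_v, a_v, a_v + e_v of (I A A+I) by three copies of V.
-- (i)  Rank formula.  For X ⊆ V let J be a basis of the cut matrix
--      A[V-X, X].  The columns e_v (v ∈ X), a_v (v ∈ J) are independent and
--      span every a_v with v ∈ X, so any S spanning e_v, a_v for all v ∈ X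
--      has r(S) ≥ |X| + c(X), and the set S_X of all copies of X has
--      r(S_X) = |X| + c(X).  Also r(M) = n, and c(V-X) = c(X) (transpose).
-- (ii) Decoding.  If X is the set of vertices with two of their three copies
--      in S, then S spans e_v, a_v for v ∈ X, as E - S does for v ∉ X.
-- So a vertical k-separation S yields X with c(X) < min(|X|, |V-X|) and
-- 2c(X) < k, while for such X the set S_X is a vertical (1 + 2c(X))-
-- separation.

open import Defs hiding (sym)
open import Data.Bool using (Bool; true; false; _∧_; _∨_; not; _xor_; if_then_else_)
open import Data.Bool.Properties
  using (∧-comm; ∧-assoc; ∧-zeroʳ; ∧-identityʳ; xor-identityʳ; xor-assoc; ∧-distribˡ-xor; ∧-distribʳ-xor;
         not-involutive; ¬-not; T-≡)
  renaming (_≟_ to _≟ᵇ_)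
open import Data.Bool.Solver using (module xor-∧-Solver)
open import Data.Bool.ListAction using (all; any)
open import Data.Nat using (ℕ; zero; suc; _+_; _*_; _∸_; _⊔_; _⊓_; _≤_; _<_; s≤s; _<ᵇ_; _≤ᵇ_; _≤?_)
open import Data.Nat.Properties
  using (≤-refl; ≤-reflexive; ≤-trans; ≤-antisym; <-irrefl; <⇒≤; <-≤-trans; ≤-<-trans; ≰⇒>; n<1+n;
         m≤n⇒m≤1+n; m≤n+m; +-comm; +-identityʳ; +-mono-≤; +-monoˡ-≤; +-monoʳ-≤; +-cancelˡ-<;
         m+n∸n≡m; m+[n∸m]≡n; +-∸-comm; ∸-monoˡ-≤; m≤m⊔n; m≤n⊔m; ⊔-sel; m⊓n≤m; m⊓n≤n; ⊓-sel;
         ⊓-pres-m<; m<n⊓o⇒m<n; m<n⊓o⇒m<o; <ᵇ⇒<; ≤ᵇ⇒≤; <⇒<ᵇ; ≤⇒≤ᵇ)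
open import Data.Nat.Tactic.RingSolver using (solve-∀)
open import Data.Fin using (Fin; zero; suc; _↑ˡ_; _↑ʳ_; splitAt) renaming (_≟_ to _≟ᶠ_)
open import Data.Fin.Properties
  using (any?; suc-injective; splitAt-↑ˡ; splitAt-↑ʳ; splitAt⁻¹-↑ˡ; splitAt⁻¹-↑ʳ)
open import Data.Fin.Subset using (Subset; ∁; ∣_∣; outside) renaming (⊥ to ∅)
open import Data.Fin.Subset.Properties using (∣∁p∣≡n∸∣p∣; ∣p∣≤n; ∣⊥∣≡0)
open import Data.Vec using ([]; _∷_; lookup; tabulate; _++_; _[_]≔_)
open import Data.Vec.Properties
  using (lookup∘tabulate; lookup-map; lookup-++ˡ; lookup-++ʳ; lookup∘update; lookup∘update′;
         lookup-replicate; tabulate-∘; tabulate-cong)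
open import Data.List using (List; []; _∷_; foldr; allFin; upTo; concatMap)
import Data.List.Relation.Unary.All as All
open import Data.List.Relation.Unary.All.Properties using (all⁺; all⁻)
open import Data.List.Relation.Unary.Any using (here; there)
open import Data.List.Relation.Unary.Any.Properties using (any⁺; any⁻)
open import Data.List.Membership.Propositional using (_∈_; lose; find)
open import Data.List.Membership.Propositional.Properties using (∈-allFin; ∈-upTo⁺; ∈-++⁺ʳ)
open import Data.Product using (Σ-syntax; _×_; _,_; ∃-syntax; proj₁; proj₂)
open import Data.Sum using (_⊎_; inj₁; inj₂; [_,_]′)
open import Data.Empty using (⊥-elim)
open import Function using (_∘_; id; Equivalence)
open import Relation.Binary.PropositionalEquality hiding (J)
open import Relation.Nullary using (¬_; yes; no)
open xor-∧-Solver using (solve; _:+_; _:*_; _:=_)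

t≢f : true ≢ false
t≢f ()

Σᵇ : (m : ℕ) → (Fin m → Bool) → Bool
Σᵇ zero    f = false
Σᵇ (suc m) f = f zero xor Σᵇ m (f ∘ suc)

Σ-cong : ∀ m {f g : Fin m → Bool} → f ≗ g → Σᵇ m f ≡ Σᵇ m g
Σ-cong zero    f≗g = refl
Σ-cong (suc m) f≗g = cong₂ _xor_ (f≗g zero) (Σ-cong m (f≗g ∘ suc))

Σ-zero : ∀ m {f : Fin m → Bool} → (∀ i → f i ≡ false) → Σᵇ m f ≡ false
Σ-zero zero    f≡0 = refl
Σ-zero (suc m) f≡0 rewrite f≡0 zero = Σ-zero m (f≡0 ∘ suc)

xor-interchange : ∀ a b c d → (a xor b) xor (c xor d) ≡ (a xor c) xor (b xor d)
xor-interchange = solve 4 (λ a b c d → (a :+ b) :+ (c :+ d) := (a :+ c) :+ (b :+ d)) refl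

Σ-xor : ∀ m (f g : Fin m → Bool) → Σᵇ m (λ i → f i xor g i) ≡ Σᵇ m f xor Σᵇ m g
Σ-xor zero    f g = refl
Σ-xor (suc m) f g =
  trans (cong ((f zero xor g zero) xor_) (Σ-xor m (f ∘ suc) (g ∘ suc)))
        (xor-interchange (f zero) (g zero) _ _)

Σ-scale : ∀ m b (f : Fin m → Bool) → Σᵇ m (λ i → b ∧ f i) ≡ b ∧ Σᵇ m f
Σ-scale m true  f = refl
Σ-scale m false f = Σ-zero m (λ i → refl)

Σ-scaleʳ : ∀ m b (f : Fin m → Bool) → Σᵇ m (λ i → f i ∧ b) ≡ Σᵇ m f ∧ b
Σ-scaleʳ m b f = trans (Σ-cong m (λ i → ∧-comm (f i) b)) (trans (Σ-scale m b f) (∧-comm b _))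

Σ-single : ∀ m {f : Fin m → Bool} (j : Fin m) → (∀ i → i ≢ j → f i ≡ false) → Σᵇ m f ≡ f j
Σ-single (suc m) {f} zero    others =
  trans (cong (f zero xor_) (Σ-zero m (λ i → others (suc i) (λ ())))) (xor-identityʳ _)
Σ-single (suc m) {f} (suc j) others rewrite others zero (λ ()) =
  Σ-single m j (λ i i≢j → others (suc i) (i≢j ∘ suc-injective))

Σ-swap : ∀ m k (h : Fin m → Fin k → Bool) →
  Σᵇ m (λ i → Σᵇ k (h i)) ≡ Σᵇ k (λ l → Σᵇ m (λ i → h i l))
Σ-swap zero    k h = sym (Σ-zero k (λ l → refl))
Σ-swap (suc m) k h =
  trans (cong (Σᵇ k (h zero) xor_) (Σ-swap m k (h ∘ suc)))
        (sym (Σ-xor k (h zero) (λ l → Σᵇ m (λ i → h (suc i) l))))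

Σ-nonzero : ∀ m (f : Fin m → Bool) → Σᵇ m f ≡ true → ∃[ i ] f i ≡ true
Σ-nonzero (suc m) f sum≡1 with f zero in f0
... | true  = zero , f0
... | false with Σ-nonzero m (f ∘ suc) sum≡1
...   | i , fi = suc i , fi

Σ-split : ∀ m k (f : Fin (m + k) → Bool) →
  Σᵇ (m + k) f ≡ Σᵇ m (λ i → f (i ↑ˡ k)) xor Σᵇ k (λ i → f (m ↑ʳ i))
Σ-split zero    k f = refl
Σ-split (suc m) k f =
  trans (cong (f zero xor_) (Σ-split m k (f ∘ suc))) (sym (xor-assoc (f zero) _ _))

unitVec-self : ∀ {m} (j : Fin m) → unitVec j j ≡ true
unitVec-self j with j ≟ᶠ j
... | yes _  = refl
... | no j≢j = ⊥-elim (j≢j refl)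

unitVec-other : ∀ {m} {i j : Fin m} → j ≢ i → unitVec j i ≡ false
unitVec-other {i = i} {j} j≢i with j ≟ᶠ i
... | yes j≡i = ⊥-elim (j≢i j≡i)
... | no _    = refl

unitVec-true : ∀ {m} {i j : Fin m} → unitVec j i ≡ true → j ≡ i
unitVec-true {i = i} {j} eq with j ≟ᶠ i
... | yes j≡i = j≡i

Σ-unit : ∀ m (j : Fin m) (f : Fin m → Bool) → Σᵇ m (λ i → unitVec j i ∧ f i) ≡ f j
Σ-unit m j f =
  trans (Σ-single m j (λ i i≢j → cong (_∧ f i) (unitVec-other (i≢j ∘ sym))))
        (cong (_∧ f j) (unitVec-self j))

_·_ : ∀ {m} → Bool → GF2Vec m → GF2Vec m
(b · u) i = b ∧ u i

lc : ∀ {n m} → Columns n m → GF2Vec m → GF2Vec n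
lc {m = m} C u x = Σᵇ m (λ j → u j ∧ C j x)

lc-cong : ∀ {n m} (C : Columns n m) {u w : GF2Vec m} → u ≗ w → lc C u ≗ lc C w
lc-cong {m = m} C u≗w x = Σ-cong m (λ j → cong (_∧ C j x) (u≗w j))

lc-zero : ∀ {n m} (C : Columns n m) {u : GF2Vec m} → (∀ j → u j ≡ false) → lc C u ≗ zeroVec
lc-zero {m = m} C u≡0 x = Σ-zero m (λ j → cong (_∧ C j x) (u≡0 j))

lc-⊕ : ∀ {n m} (C : Columns n m) (u w : GF2Vec m) → lc C (u ⊕ w) ≗ lc C u ⊕ lc C w
lc-⊕ {m = m} C u w x =
  trans (Σ-cong m (λ j → ∧-distribʳ-xor (C j x) (u j) (w j))) (Σ-xor m _ _)

lc-scale : ∀ {n m} (C : Columns n m) b (u : GF2Vec m) → lc C (b · u) ≗ b · lc C u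
lc-scale {m = m} C b u x = trans (Σ-cong m (λ j → ∧-assoc b (u j) (C j x))) (Σ-scale m b _)

lc-unit : ∀ {n m} (C : Columns n m) (j : Fin m) → lc C (unitVec j) ≗ C j
lc-unit {m = m} C j x = Σ-unit m j (λ i → C i x)

unitColumns : ∀ n → Columns n n
unitColumns n = unitVec

lc-unitColumns : ∀ n (u : GF2Vec n) → lc (unitColumns n) u ≗ u
lc-unitColumns n u x =
  trans (Σ-single n x (λ i i≢x → trans (cong (u i ∧_) (unitVec-other i≢x)) (∧-zeroʳ (u i))))
        (trans (cong (u x ∧_) (unitVec-self x)) (∧-identityʳ (u x)))

_⊆ᶠ_ : ∀ {m} → (Fin m → Bool) → (Fin m → Bool) → Set
u ⊆ᶠ v = ∀ j → u j ≡ true → v j ≡ true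

Nonzero : ∀ {m} → (Fin m → Bool) → Set
Nonzero u = ∃[ j ] u j ≡ true

Indep : ∀ {n m} → Columns n m → Subset m → Set
Indep C T = ∀ u → u ⊆ᶠ lookup T → Nonzero u → ¬ (lc C u ≗ zeroVec)

InSpan : ∀ {n m} → Columns n m → (Fin m → Bool) → GF2Vec n → Set
InSpan C R v = ∃[ u ] (u ⊆ᶠ R × lc C u ≗ v)

∧-true : ∀ {a b} → a ∧ b ≡ true → a ≡ true × b ≡ true
∧-true {true} {true} refl = refl , refl

unitVec-⊆ : ∀ {m} {R : Fin m → Bool} {j} → R j ≡ true → unitVec j ⊆ᶠ R
unitVec-⊆ {R = R} Rj i e = subst (λ k → R k ≡ true) (unitVec-true e) Rj

⊕-⊆ : ∀ {m} {R : Fin m → Bool} {u w : GF2Vec m} → u ⊆ᶠ R → w ⊆ᶠ R → (u ⊕ w) ⊆ᶠ R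
⊕-⊆ {u = u} u⊆R w⊆R j e with u j in uj
... | true  = u⊆R j uj
... | false = w⊆R j e

·-⊆ : ∀ {m} {R : Fin m → Bool} b {u : GF2Vec m} → u ⊆ᶠ R → (b · u) ⊆ᶠ R
·-⊆ true u⊆R = u⊆R

card-empty : ∀ {m} (T : Subset m) → (∀ j → lookup T j ≡ false) → ∣ T ∣ ≡ 0
card-empty []          none = refl
card-empty (true ∷ T)  none with none zero
... | ()
card-empty (false ∷ T) none = card-empty T (none ∘ suc)

card-remove : ∀ {m} (T : Subset m) j → lookup T j ≡ true → ∣ T ∣ ≡ suc ∣ T [ j ]≔ false ∣
card-remove (true ∷ T)  zero    refl = refl
card-remove (true ∷ T)  (suc j) Tj   = cong suc (card-remove T j Tj)
card-remove (false ∷ T) (suc j) Tj   = card-remove T j Tj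

card-insert : ∀ {m} (T : Subset m) j → lookup T j ≡ false → ∣ T [ j ]≔ true ∣ ≡ suc ∣ T ∣
card-insert (false ∷ T) zero    refl = refl
card-insert (true ∷ T)  (suc j) Tj   = cong suc (card-insert T j Tj)
card-insert (false ∷ T) (suc j) Tj   = card-insert T j Tj

update-other : ∀ {m} (T : Subset m) {i j} b → lookup (T [ j ]≔ b) i ≡ true → i ≢ j → lookup T i ≡ true
update-other T b e i≢j = trans (sym (lookup∘update′ i≢j T b)) e

card-++ : ∀ {m k} (X : Subset m) (Y : Subset k) → ∣ X ++ Y ∣ ≡ ∣ X ∣ + ∣ Y ∣
card-++ []          Y = refl
card-++ (true ∷ X)  Y = cong suc (card-++ X Y)
card-++ (false ∷ X) Y = card-++ X Y

guarded-zero : ∀ b {a} → (b ≡ false → a ≡ false) → not b ∧ a ≡ false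
guarded-zero true  _ = refl
guarded-zero false h = h refl

zero-or-nonzero : ∀ {m} (u : GF2Vec m) → Nonzero u ⊎ (∀ j → u j ≡ false)
zero-or-nonzero u with any? (λ j → u j ≟ᵇ true)
... | yes nz = inj₁ nz
... | no  z  = inj₂ (λ j → ¬-not (λ uj → z (j , uj)))

card-∁ : ∀ {m} (X : Subset m) → ∣ X ∣ + ∣ ∁ X ∣ ≡ m
card-∁ X = trans (cong (∣ X ∣ +_) (∣∁p∣≡n∸∣p∣ X)) (m+[n∸m]≡n (∣p∣≤n X))

∁-lookup : ∀ {m} (X : Subset m) i → lookup (∁ X) i ≡ not (lookup X i)
∁-lookup X i = lookup-map i not X

∁-involutive : ∀ {m} (X : Subset m) → ∁ (∁ X) ≡ X
∁-involutive []      = refl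
∁-involutive (b ∷ X) = cong₂ _∷_ (not-involutive b) (∁-involutive X)

span-col : ∀ {n m} (C : Columns n m) (R : Fin m → Bool) j → R j ≡ true → InSpan C R (C j)
span-col C R j Rj = unitVec j , unitVec-⊆ Rj , lc-unit C j

span-cong : ∀ {n m} (C : Columns n m) (R : Fin m → Bool) {v w : GF2Vec n} →
  v ≗ w → InSpan C R v → InSpan C R w
span-cong C R v≗w (u , u⊆R , lc≗v) = u , u⊆R , λ x → trans (lc≗v x) (v≗w x)

span-⊕ : ∀ {n m} (C : Columns n m) (R : Fin m → Bool) {v w : GF2Vec n} →
  InSpan C R v → InSpan C R w → InSpan C R (v ⊕ w)
span-⊕ C R (u , u⊆R , lc≗v) (u′ , u′⊆R , lc≗w) =
  u ⊕ u′ , ⊕-⊆ u⊆R u′⊆R , λ x → trans (lc-⊕ C u u′ x) (cong₂ _xor_ (lc≗v x) (lc≗w x))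

all-true : ∀ {A : Set} (p : A → Bool) {L : List A} → all p L ≡ true → ∀ {x} → x ∈ L → p x ≡ true
all-true p {L} h x∈L = Equivalence.to T-≡ (All.lookup (all⁺ p L (Equivalence.from T-≡ h)) x∈L)

all-intro : ∀ {A : Set} (p : A → Bool) (L : List A) → (∀ x → p x ≡ true) → all p L ≡ true
all-intro p L h = Equivalence.to T-≡ (all⁻ p (All.universal (λ x → Equivalence.from T-≡ (h x)) L))

all-false : ∀ {A : Set} (p : A → Bool) (L : List A) → all p L ≡ false → ∃[ x ] p x ≡ false
all-false p (y ∷ L) h with p y in py
... | false = y , py
... | true  = all-false p L h

any-intro : ∀ {A : Set} (p : A → Bool) {L : List A} {x} → x ∈ L → p x ≡ true → any p L ≡ true
any-intro p x∈L px = Equivalence.to T-≡ (any⁺ p (lose x∈L (Equivalence.from T-≡ px)))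

any-elim : ∀ {A : Set} (p : A → Bool) (L : List A) → any p L ≡ true → ∃[ x ] p x ≡ true
any-elim p L h with find (any⁻ p L (Equivalence.from T-≡ h))
... | x , _ , px = x , Equivalence.to T-≡ px

∈-allSubsets : ∀ {m} (U : Subset m) → U ∈ allSubsets m
∈-allSubsets []      = here refl
∈-allSubsets (b ∷ U) = extend b (allSubsets _) (∈-allSubsets U)
  where
  extend : ∀ {m} b {U : Subset m} L → U ∈ L →
    (b ∷ U) ∈ concatMap (λ s → (true ∷ s) ∷ (false ∷ s) ∷ []) L
  extend true  (V ∷ L) (here refl) = here refl
  extend false (V ∷ L) (here refl) = there (here refl)
  extend b     (V ∷ L) (there U∈L) = ∈-++⁺ʳ ((true ∷ V) ∷ (false ∷ V) ∷ []) (extend b L U∈L)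

subsetᵇ-sound : ∀ {m} (U T : Subset m) → subsetᵇ U T ≡ true → lookup U ⊆ᶠ lookup T
subsetᵇ-sound {m} U T h j Uj with all-true _ {allFin m} h (∈-allFin j)
... | implication rewrite Uj = implication

subsetᵇ-complete : ∀ {m} (U T : Subset m) → lookup U ⊆ᶠ lookup T → subsetᵇ U T ≡ true
subsetᵇ-complete {m} U T U⊆T = all-intro _ (allFin m) (λ j → implies (lookup U j) (lookup T j) (U⊆T j))
  where
  implies : ∀ a b → (a ≡ true → b ≡ true) → (not a ∨ b) ≡ true
  implies true  b f = f refl
  implies false b f = refl

nonemptyᵇ-sound : ∀ {m} (U : Subset m) → nonemptyᵇ U ≡ true → Nonzero (lookup U)
nonemptyᵇ-sound {m} U h = any-elim _ (allFin m) h

nonemptyᵇ-complete : ∀ {m} (U : Subset m) → Nonzero (lookup U) → nonemptyᵇ U ≡ true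
nonemptyᵇ-complete U (j , Uj) = any-intro _ (∈-allFin j) Uj

isZeroVec-sound : ∀ {n} (v : GF2Vec n) → isZeroVec v ≡ true → v ≗ zeroVec
isZeroVec-sound {n} v h x with v x in vx | all-true _ {allFin n} h (∈-allFin x)
... | false | _ = refl
... | true  | ()

isZeroVec-complete : ∀ {n} (v : GF2Vec n) → v ≗ zeroVec → isZeroVec v ≡ true
isZeroVec-complete {n} v v≗0 = all-intro _ (allFin n) (λ x → cong not (v≗0 x))

colSum-lc : ∀ {n m} (C : Columns n m) (U : Subset m) → colSum C U ≗ lc C (lookup U)
colSum-lc {m = m} C U x = trans (fold-lc (allFin m) x) (fold-Σ m id)
  where
  term : Fin m → Bool
  term j = lookup U j ∧ C j x
  fold-lc : ∀ L x → foldr (λ j acc → if lookup U j then C j ⊕ acc else acc) zeroVec L x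
                  ≡ foldr (λ j b → (lookup U j ∧ C j x) xor b) false L
  fold-lc []      x = refl
  fold-lc (j ∷ L) x with lookup U j
  ... | true  = cong (C j x xor_) (fold-lc L x)
  ... | false = fold-lc L x
  fold-Σ : ∀ k (g : Fin k → Fin m) →
    foldr (λ j b → term j xor b) false (Data.List.tabulate g) ≡ Σᵇ k (term ∘ g)
  fold-Σ zero    g = refl
  fold-Σ (suc k) g = cong (term (g zero) xor_) (fold-Σ k (g ∘ suc))

independentᵇ-sound : ∀ {n m} (C : Columns n m) (T : Subset m) → independentᵇ C T ≡ true → Indep C T
independentᵇ-sound {m = m} C T h u u⊆T u≢0 lc≗0 = t≢f (trans (sym verdict) refuted)
  where
  U = tabulate u
  verdict = all-true _ h (∈-allSubsets U)
  refuted : (not (subsetᵇ U T ∧ nonemptyᵇ U) ∨ not (isZeroVec (colSum C U))) ≡ false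
  refuted
    rewrite subsetᵇ-complete U T (λ j e → u⊆T j (trans (sym (lookup∘tabulate u j)) e))
          | nonemptyᵇ-complete U (proj₁ u≢0 , trans (lookup∘tabulate u _) (proj₂ u≢0))
          | isZeroVec-complete (colSum C U)
              (λ x → trans (colSum-lc C U x) (trans (lc-cong C (lookup∘tabulate u) x) (lc≗0 x)))
          = refl

independentᵇ-complete : ∀ {n m} (C : Columns n m) (T : Subset m) → Indep C T → independentᵇ C T ≡ true
independentᵇ-complete {m = m} C T I = all-intro _ (allSubsets m) verdict
  where
  verdict : ∀ U → (not (subsetᵇ U T ∧ nonemptyᵇ U) ∨ not (isZeroVec (colSum C U))) ≡ true
  verdict U with subsetᵇ U T in U⊆T | nonemptyᵇ U in U≢0 | isZeroVec (colSum C U) in U≗0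
  ... | true  | true  | true  = ⊥-elim (I (lookup U) (subsetᵇ-sound U T U⊆T) (nonemptyᵇ-sound U U≢0)
                                   (λ x → trans (sym (colSum-lc C U x)) (isZeroVec-sound _ U≗0 x)))
  ... | true  | true  | false = refl
  ... | true  | false | _     = refl
  ... | false | _     | _     = refl

dependency : ∀ {n m} (C : Columns n m) (T : Subset m) → independentᵇ C T ≡ false →
  ∃[ u ] (u ⊆ᶠ lookup T × Nonzero u × lc C u ≗ zeroVec)
dependency {m = m} C T h with all-false _ (allSubsets m) h
... | U , fails = witness fails
  where
  witness : (not (subsetᵇ U T ∧ nonemptyᵇ U) ∨ not (isZeroVec (colSum C U))) ≡ false →
    ∃[ u ] (u ⊆ᶠ lookup T × Nonzero u × lc C u ≗ zeroVec)
  witness e with subsetᵇ U T in U⊆T | nonemptyᵇ U in U≢0 | isZeroVec (colSum C U) in U≗0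
  witness refl | true | true | true =
    lookup U , subsetᵇ-sound U T U⊆T , nonemptyᵇ-sound U U≢0 ,
    (λ x → trans (sym (colSum-lc C U x)) (isZeroVec-sound _ U≗0 x))

maxOver : ∀ {A : Set} → (A → Bool) → (A → ℕ) → List A → ℕ
maxOver q f = foldr (λ a acc → if q a then f a ⊔ acc else acc) 0

maxOver-upper : ∀ {A : Set} (q : A → Bool) (f : A → ℕ) {x} (L : List A) →
  x ∈ L → q x ≡ true → f x ≤ maxOver q f L
maxOver-upper q f (y ∷ L) (here refl) qy rewrite qy = m≤m⊔n (f y) _
maxOver-upper q f (y ∷ L) (there x∈L) qx with q y
... | true  = ≤-trans (maxOver-upper q f L x∈L qx) (m≤n⊔m (f y) _)
... | false = maxOver-upper q f L x∈L qx

maxOver-attained : ∀ {A : Set} (q : A → Bool) (f : A → ℕ) (L : List A) →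
  maxOver q f L ≡ 0 ⊎ ∃[ x ] (q x ≡ true × maxOver q f L ≡ f x)
maxOver-attained q f [] = inj₁ refl
maxOver-attained q f (y ∷ L) with q y in qy
... | false = maxOver-attained q f L
... | true with ⊔-sel (f y) (maxOver q f L)
...   | inj₁ max≡fy = inj₂ (y , qy , max≡fy)
...   | inj₂ max≡rest with maxOver-attained q f L
...     | inj₁ rest≡0           = inj₁ (trans max≡rest rest≡0)
...     | inj₂ (x , qx , rest≡fx) = inj₂ (x , qx , trans max≡rest rest≡fx)

minOver : (ℕ → Bool) → ℕ → List ℕ → ℕ
minOver q d = foldr (λ k acc → if q k then k ⊓ acc else acc) d

minOver-lower : ∀ q d {k} (L : List ℕ) → k ∈ L → q k ≡ true → minOver q d L ≤ k
minOver-lower q d (y ∷ L) (here refl) qy rewrite qy = m⊓n≤m y _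
minOver-lower q d (y ∷ L) (there k∈L) qk with q y
... | true  = ≤-trans (m⊓n≤n y _) (minOver-lower q d L k∈L qk)
... | false = minOver-lower q d L k∈L qk

minOver-attained : ∀ q d (L : List ℕ) → minOver q d L ≡ d ⊎ ∃[ k ] (q k ≡ true × minOver q d L ≡ k)
minOver-attained q d [] = inj₁ refl
minOver-attained q d (y ∷ L) with q y in qy
... | false = minOver-attained q d L
... | true with ⊓-sel y (minOver q d L)
...   | inj₁ min≡y = inj₂ (y , qy , min≡y)
...   | inj₂ min≡rest with minOver-attained q d L
...     | inj₁ rest≡d           = inj₁ (trans min≡rest rest≡d)
...     | inj₂ (k , qk , rest≡k) = inj₂ (k , qk , trans min≡rest rest≡k)

minOver-≤-default : ∀ q d (L : List ℕ) → minOver q d L ≤ d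
minOver-≤-default q d []      = ≤-refl
minOver-≤-default q d (y ∷ L) with q y
... | true  = ≤-trans (m⊓n≤n y _) (minOver-≤-default q d L)
... | false = minOver-≤-default q d L

Expresses : ∀ {n m k} → Columns n k → (Fin k → Bool) → Columns n m → (Fin m → Bool) → Set
Expresses {m = m} {k} D R C T =
  Σ[ cf ∈ (Fin m → GF2Vec k) ] (∀ j → T j ≡ true → cf j ⊆ᶠ R × lc D (cf j) ≗ C j)

choose : ∀ {n m k} (D : Columns n k) (R : Fin k → Bool) (C : Columns n m) (T : Fin m → Bool) →
  (∀ j → T j ≡ true → InSpan D R (C j)) → Expresses D R C T
choose {k = k} D R C T spans = (λ j → pick j (T j) refl) , (λ j Tj → picked j (T j) refl Tj)
  where
  pick : ∀ j b → T j ≡ b → GF2Vec k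
  pick j true  Tj = proj₁ (spans j Tj)
  pick j false _  = zeroVec
  picked : ∀ j b (e : T j ≡ b) → b ≡ true → pick j b e ⊆ᶠ R × lc D (pick j b e) ≗ C j
  picked j true Tj _ = proj₂ (spans j Tj)

drop-first : ∀ {n m k} (D : Columns n (suc k)) (b : Bool) (R : Subset k) (C : Columns n m) T →
  (E : Expresses D (lookup (b ∷ R)) C T) → (∀ j → T j ≡ true → proj₁ E j zero ≡ false) →
  Expresses (D ∘ suc) (lookup R) C T
drop-first D b R C T (cf , expr) unused =
  (λ j → cf j ∘ suc) , λ j Tj → (λ i → proj₁ (expr j Tj) (suc i)) , tail j Tj
  where
  tail : ∀ j → T j ≡ true → lc (D ∘ suc) (cf j ∘ suc) ≗ C j
  tail j Tj x rewrite sym (proj₂ (expr j Tj) x) | unused j Tj = refl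

shear : ∀ {n m} → Columns n m → (b : GF2Vec m) → Fin m → Columns n m
shear C b j₀ j = C j ⊕ (b j · C j₀)

lc-shear : ∀ {n m} (C : Columns n m) b j₀ (u : GF2Vec m) →
  lc (shear C b j₀) u ≗ lc C (u ⊕ (Σᵇ m (λ j → u j ∧ b j) · unitVec j₀))
lc-shear {m = m} C b j₀ u x = begin
  lc (shear C b j₀) u x
    ≡⟨ Σ-cong m (λ j → trans (∧-distribˡ-xor (u j) (C j x) _)
                          (cong ((u j ∧ C j x) xor_) (sym (∧-assoc (u j) (b j) _)))) ⟩
  Σᵇ m (λ j → (u j ∧ C j x) xor ((u j ∧ b j) ∧ C j₀ x))
    ≡⟨ trans (Σ-xor m _ _) (cong (lc C u x xor_) (Σ-scaleʳ m (C j₀ x) (λ j → u j ∧ b j))) ⟩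
  lc C u x xor (p ∧ C j₀ x)
    ≡⟨ cong (lc C u x xor_)
         (trans (cong (p ∧_) (sym (lc-unit C j₀ x))) (sym (lc-scale C p (unitVec j₀) x))) ⟩
  lc C u x xor lc C (p · unitVec j₀) x
    ≡⟨ sym (lc-⊕ C u (p · unitVec j₀) x) ⟩
  lc C (u ⊕ (p · unitVec j₀)) x ∎
  where
  open ≡-Reasoning
  p = Σᵇ m (λ j → u j ∧ b j)

shear-independent : ∀ {n m} (C : Columns n m) (T : Subset m) (b : GF2Vec m) j₀ →
  lookup T j₀ ≡ true → Indep C T → Indep (shear C b j₀) (T [ j₀ ]≔ false)
shear-independent {m = m} C T b j₀ Tj₀ I u u⊆T′ (i₀ , ui₀) lc≗0 =
  I u′ u′⊆T (i₀ , u′i₀) (λ x → trans (sym (lc-shear C b j₀ u x)) (lc≗0 x))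
  where
  p = Σᵇ m (λ j → u j ∧ b j)
  u′ = u ⊕ (p · unitVec j₀)
  i₀≢j₀ : i₀ ≢ j₀
  i₀≢j₀ refl = t≢f (trans (sym (u⊆T′ i₀ ui₀)) (lookup∘update j₀ T false))
  u⊆T : u ⊆ᶠ lookup T
  u⊆T i ui with i ≟ᶠ j₀
  ... | yes refl = Tj₀
  ... | no i≢j₀  = update-other T false (u⊆T′ i ui) i≢j₀
  u′⊆T : u′ ⊆ᶠ lookup T
  u′⊆T = ⊕-⊆ u⊆T (·-⊆ p (unitVec-⊆ Tj₀))
  u′i₀ : u′ i₀ ≡ true
  u′i₀ rewrite ui₀ | unitVec-other (i₀≢j₀ ∘ sym) = cong not (∧-zeroʳ p)

xor-solve : ∀ {a t c} → a xor t ≡ c → t ≡ c xor a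
xor-solve {true}  {true}  refl = refl
xor-solve {true}  {false} refl = refl
xor-solve {false} refl = sym (xor-identityʳ _)

shear-expresses : ∀ {n m k} (D : Columns n (suc k)) (R : Subset k) (C : Columns n m) (T : Subset m) →
  (E : Expresses D (lookup (true ∷ R)) C (lookup T)) →
  ∀ j₀ → lookup T j₀ ≡ true → proj₁ E j₀ zero ≡ true →
  Expresses (D ∘ suc) (lookup R) (shear C (λ j → proj₁ E j zero) j₀) (lookup (T [ j₀ ]≔ false))
shear-expresses {m = m} {k} D R C T (cf , expr) j₀ Tj₀ pivot = w , λ j Tj′ → spans j (inT j Tj′)
  where
  b : GF2Vec m
  b j = cf j zero
  w : Fin m → GF2Vec k
  w j = (cf j ∘ suc) ⊕ (b j · (cf j₀ ∘ suc))
  inT : ∀ j → lookup (T [ j₀ ]≔ false) j ≡ true → lookup T j ≡ true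
  inT j Tj′ with j ≟ᶠ j₀
  ... | yes refl = Tj₀
  ... | no j≢j₀  = update-other T false Tj′ j≢j₀
  rest : ∀ j → lookup T j ≡ true → ∀ x → lc (D ∘ suc) (cf j ∘ suc) x ≡ C j x xor (b j ∧ D zero x)
  rest j Tj x = xor-solve (proj₂ (expr j Tj) x)
  identity : ∀ c β d c₀ → ((c xor (β ∧ d)) xor (β ∧ (c₀ xor d))) ≡ (c xor (β ∧ c₀))
  identity = solve 4 (λ c β d c₀ → (c :+ (β :* d)) :+ (β :* (c₀ :+ d)) := c :+ (β :* c₀)) refl
  spans : ∀ j → lookup T j ≡ true → w j ⊆ᶠ lookup R × lc (D ∘ suc) (w j) ≗ shear C b j₀ j
  spans j Tj = ⊕-⊆ (proj₁ (expr j Tj) ∘ suc) (·-⊆ (b j) (proj₁ (expr j₀ Tj₀) ∘ suc)) , λ x → begin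
    lc (D ∘ suc) (w j) x
      ≡⟨ trans (lc-⊕ (D ∘ suc) (cf j ∘ suc) (b j · (cf j₀ ∘ suc)) x)
           (cong (lc (D ∘ suc) (cf j ∘ suc) x xor_) (lc-scale (D ∘ suc) (b j) (cf j₀ ∘ suc) x)) ⟩
    lc (D ∘ suc) (cf j ∘ suc) x xor (b j ∧ lc (D ∘ suc) (cf j₀ ∘ suc) x)
      ≡⟨ cong₂ (λ s t → s xor (b j ∧ t)) (rest j Tj x) (rest j₀ Tj₀ x) ⟩
    (C j x xor (b j ∧ D zero x)) xor (b j ∧ (C j₀ x xor (b j₀ ∧ D zero x)))
      ≡⟨ cong (λ β → (C j x xor (b j ∧ D zero x)) xor (b j ∧ (C j₀ x xor (β ∧ D zero x)))) pivot ⟩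
    (C j x xor (b j ∧ D zero x)) xor (b j ∧ (C j₀ x xor D zero x))
      ≡⟨ identity (C j x) (b j) (D zero x) (C j₀ x) ⟩
    shear C b j₀ j x ∎
    where open ≡-Reasoning

-- By
-- induction on R: drop the first column of D if no column of T uses it,
-- otherwise pivot on a column j₀ using it and shear that column away.
steinitz : ∀ {n m k} (C : Columns n m) (T : Subset m) (D : Columns n k) (R : Subset k) →
  Indep C T → Expresses D (lookup R) C (lookup T) → ∣ T ∣ ≤ ∣ R ∣
steinitz C T D [] I (cf , expr) = ≤-reflexive (card-empty T absent)
  where
  absent : ∀ j → lookup T j ≡ false
  absent j with lookup T j in Tj
  ... | false = refl
  ... | true  = ⊥-elim (I (unitVec j) (unitVec-⊆ Tj) (j , unitVec-self j)
                          (λ x → trans (lc-unit C j x) (sym (proj₂ (expr j Tj) x))))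
steinitz C T D (false ∷ R) I E =
  steinitz C T (D ∘ suc) R I (drop-first D false R C (lookup T) E unused)
  where
  unused : ∀ j → lookup T j ≡ true → proj₁ E j zero ≡ false
  unused j Tj with proj₁ E j zero in e
  ... | false = refl
  ... | true  = ⊥-elim (t≢f (sym (proj₁ (proj₂ E j Tj) zero e)))
steinitz C T D (true ∷ R) I E with any? (λ j → lookup T j ∧ proj₁ E j zero ≟ᵇ true)
... | no none =
  m≤n⇒m≤1+n (steinitz C T (D ∘ suc) R I (drop-first D true R C (lookup T) E unused))
  where
  unused : ∀ j → lookup T j ≡ true → proj₁ E j zero ≡ false
  unused j Tj with proj₁ E j zero in e
  ... | false = refl
  ... | true  = ⊥-elim (none (j , trans (cong (_∧ proj₁ E j zero) Tj) e))
... | yes (j₀ , used) =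
  subst (_≤ suc ∣ R ∣) (sym (card-remove T j₀ Tj₀))
    (s≤s (steinitz (shear C (λ j → proj₁ E j zero) j₀) (T [ j₀ ]≔ false) (D ∘ suc) R
           (shear-independent C T _ j₀ Tj₀ I) (shear-expresses D R C T E j₀ Tj₀ pivot)))
  where
  Tj₀ = proj₁ (∧-true used)
  pivot = proj₂ (∧-true {lookup T j₀} used)

rank-upper : ∀ {n m} (C : Columns n m) (S T : Subset m) →
  lookup T ⊆ᶠ lookup S → Indep C T → ∣ T ∣ ≤ rank C S
rank-upper {m = m} C S T T⊆S I =
  maxOver-upper (λ U → subsetᵇ U S ∧ independentᵇ C U) ∣_∣ (allSubsets m) (∈-allSubsets T) admissible
  where
  admissible : (subsetᵇ T S ∧ independentᵇ C T) ≡ true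
  admissible rewrite subsetᵇ-complete T S T⊆S | independentᵇ-complete C T I = refl

record Basis {n m} (C : Columns n m) (S : Subset m) : Set where
  field
    set         : Subset m
    ⊆S          : lookup set ⊆ᶠ lookup S
    independent : Indep C set
    size        : rank C S ≡ ∣ set ∣

basis : ∀ {n m} (C : Columns n m) (S : Subset m) → Basis C S
basis {m = m} C S with maxOver-attained (λ U → subsetᵇ U S ∧ independentᵇ C U) ∣_∣ (allSubsets m)
... | inj₁ rank≡0 = record
  { set = ∅ ; ⊆S = λ j e → ⊥-elim (t≢f (trans (sym e) (lookup-replicate j outside)))
  ; independent = λ u u⊆⊥ (j , uj) _ → t≢f (trans (sym (u⊆⊥ j uj)) (lookup-replicate j outside))
  ; size = trans rank≡0 (sym (∣⊥∣≡0 m)) }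
... | inj₂ (T , admissible , rank≡) = record
  { set = T ; ⊆S = subsetᵇ-sound T S (proj₁ (∧-true admissible))
  ; independent = independentᵇ-sound C T (proj₂ (∧-true {subsetᵇ T S} admissible))
  ; size = rank≡ }

-- A basis spans each column of S: otherwise adding the column to the basis
-- would give a larger independent subset of S.
module _ {n m} (C : Columns n m) (S : Subset m) (B : Basis C S) where
  open Basis B renaming (set to T)

  private
    T+_ : Fin m → Subset m
    T+ j = T [ j ]≔ true

    T+-⊆ : ∀ {j} → lookup S j ≡ true → lookup (T+ j) ⊆ᶠ lookup S
    T+-⊆ {j} Sj i e with i ≟ᶠ j
    ... | yes refl = Sj
    ... | no i≢j   = ⊆S i (update-other T true e i≢j)

    solve-for : ∀ {j} u → u ⊆ᶠ lookup (T+ j) → u j ≡ true → lc C u ≗ zeroVec → InSpan C (lookup T) (C j)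
    solve-for {j} u u⊆T+j uj lc≗0 =
      u ⊕ unitVec j , ⊆T , λ x → trans (lc-⊕ C u (unitVec j) x) (cong₂ _xor_ (lc≗0 x) (lc-unit C j x))
      where
      ⊆T : (u ⊕ unitVec j) ⊆ᶠ lookup T
      ⊆T i e with i ≟ᶠ j
      ... | yes refl rewrite uj | unitVec-self j = ⊥-elim (t≢f (sym e))
      ... | no i≢j rewrite unitVec-other (i≢j ∘ sym) =
        update-other T true (u⊆T+j i (trans (sym (xor-identityʳ (u i))) e)) i≢j

    not-using : ∀ {j} u → u ⊆ᶠ lookup (T+ j) → u j ≡ false → u ⊆ᶠ lookup T
    not-using {j} u u⊆T+j uj i ui with i ≟ᶠ j
    ... | yes refl = ⊥-elim (t≢f (trans (sym ui) uj))
    ... | no i≢j   = update-other T true (u⊆T+j i ui) i≢j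

  basis-spans : ∀ j → lookup S j ≡ true → InSpan C (lookup T) (C j)
  basis-spans j Sj with lookup T j in Tj
  ... | true = span-col C (lookup T) j Tj
  ... | false with independentᵇ C (T+ j) in T+j-indep
  ...   | true = ⊥-elim (<-irrefl refl (subst₂ _≤_ (card-insert T j Tj) size
                   (rank-upper C S (T+ j) (T+-⊆ Sj) (independentᵇ-sound C (T+ j) T+j-indep))))
  ...   | false with dependency C (T+ j) T+j-indep
  ...     | u , u⊆T+j , u≢0 , lc≗0 with u j in uj
  ...       | true  = solve-for u u⊆T+j uj lc≗0
  ...       | false = ⊥-elim (independent u (not-using u u⊆T+j uj) u≢0 lc≗0)

span-trans : ∀ {n k l} (D : Columns n k) (E : Columns n l) (R : Fin k → Bool) (Q : Fin l → Bool) {w : GF2Vec n} →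
  InSpan D R w → (∀ i → R i ≡ true → InSpan E Q (D i)) → InSpan E Q w
span-trans {n} {k} {l} D E R Q {w} (u , u⊆R , lc≗w) spans = v , v⊆Q , lc≗
  where
  cf = proj₁ (choose E Q D R spans)
  expr = proj₂ (choose E Q D R spans)
  v : GF2Vec l
  v t = Σᵇ k (λ i → u i ∧ cf i t)
  v⊆Q : v ⊆ᶠ Q
  v⊆Q t vt with Σ-nonzero k _ vt
  ... | i , uicf = proj₁ (expr i (u⊆R i (proj₁ (∧-true uicf)))) t (proj₂ (∧-true {u i} uicf))
  term : ∀ x i → u i ∧ lc E (cf i) x ≡ u i ∧ D i x
  term x i with u i in ui
  ... | true  = proj₂ (expr i (u⊆R i ui)) x
  ... | false = refl
  lc≗ : lc E v ≗ w
  lc≗ x = begin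
    lc E v x
      ≡⟨ Σ-cong l (λ t → trans (sym (Σ-scaleʳ k (E t x) (λ i → u i ∧ cf i t)))
                               (Σ-cong k (λ i → ∧-assoc (u i) _ _))) ⟩
    Σᵇ l (λ t → Σᵇ k (λ i → u i ∧ (cf i t ∧ E t x)))
      ≡⟨ Σ-swap l k _ ⟩
    Σᵇ k (λ i → Σᵇ l (λ t → u i ∧ (cf i t ∧ E t x)))
      ≡⟨ Σ-cong k (λ i → trans (Σ-scale l (u i) _) (term x i)) ⟩
    lc D u x
      ≡⟨ lc≗w x ⟩
    w x ∎
    where open ≡-Reasoning

rank-≤-spanner : ∀ {n m k} (C : Columns n m) (S : Subset m) (D : Columns n k) (R : Subset k) →
  (∀ j → lookup S j ≡ true → InSpan D (lookup R) (C j)) → rank C S ≤ ∣ R ∣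
rank-≤-spanner C S D R spans =
  subst (_≤ ∣ R ∣) (sym size)
    (steinitz C T D R independent (choose D (lookup R) C (lookup T) (λ j Tj → spans j (⊆S j Tj))))
  where open Basis (basis C S) renaming (set to T)

rank-≥-spanned : ∀ {n m k} (C : Columns n m) (S : Subset m) (D : Columns n k) (R : Subset k) →
  Indep D R → (∀ i → lookup R i ≡ true → InSpan C (lookup S) (D i)) → ∣ R ∣ ≤ rank C S
rank-≥-spanned C S D R I spans =
  subst (∣ R ∣ ≤_) (sym size)
    (steinitz D R C T I (choose C (lookup T) D (lookup R)
      (λ i Ri → span-trans C C (lookup S) (lookup T) (spans i Ri) (basis-spans C S B))))
  where
  B = basis C S
  open Basis B renaming (set to T)

↑-view : ∀ m k (i : Fin (m + k)) → (∃[ v ] i ≡ v ↑ˡ k) ⊎ (∃[ v ] i ≡ m ↑ʳ v)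
↑-view m k i with splitAt m i in e
... | inj₁ v = inj₁ (v , sym (splitAt⁻¹-↑ˡ e))
... | inj₂ v = inj₂ (v , sym (splitAt⁻¹-↑ʳ e))

module _ {n : ℕ} where
  -- the copies of v indexing the columns e_v, a_v and a_v + e_v
  copyI copyA copyS : Fin n → Fin (n + (n + n))
  copyI v = v ↑ˡ (n + n)
  copyA v = n ↑ʳ (v ↑ˡ n)
  copyS v = n ↑ʳ (n ↑ʳ v)

  copy-view : ∀ (j : Fin (n + (n + n))) →
    (∃[ v ] j ≡ copyI v) ⊎ (∃[ v ] j ≡ copyA v) ⊎ (∃[ v ] j ≡ copyS v)
  copy-view j with ↑-view n (n + n) j
  ... | inj₁ (v , e) = inj₁ (v , e)
  ... | inj₂ (j′ , e) with ↑-view n n j′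
  ...   | inj₁ (v , e′) = inj₂ (inj₁ (v , trans e (cong (n ↑ʳ_) e′)))
  ...   | inj₂ (v , e′) = inj₂ (inj₂ (v , trans e (cong (n ↑ʳ_) e′)))

  vertex : Fin (n + (n + n)) → Fin n
  vertex j = [ id , (λ j′ → [ id , id ]′ (splitAt n j′)) ]′ (splitAt n j)

  vertex-I : ∀ v → vertex (copyI v) ≡ v
  vertex-I v rewrite splitAt-↑ˡ n v (n + n) = refl

  vertex-A : ∀ v → vertex (copyA v) ≡ v
  vertex-A v rewrite splitAt-↑ʳ n (n + n) (v ↑ˡ n) | splitAt-↑ˡ n v n = refl

  vertex-S : ∀ v → vertex (copyS v) ≡ v
  vertex-S v rewrite splitAt-↑ʳ n (n + n) (n ↑ʳ v) | splitAt-↑ʳ n n v = refl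

  copies : Subset n → Subset (n + (n + n))
  copies X = tabulate (lookup X ∘ vertex)

module _ {n : ℕ} (G : Graph n) where
  IAS-I : ∀ v → IAS G (copyI v) ≗ unitVec v
  IAS-I v x rewrite splitAt-↑ˡ n v (n + n) = refl

  IAS-A : ∀ v → IAS G (copyA v) ≗ adjCol G v
  IAS-A v x rewrite splitAt-↑ʳ n (n + n) (v ↑ˡ n) | splitAt-↑ˡ n v n = refl

  IAS-S : ∀ v → IAS G (copyS v) ≗ adjCol G v ⊕ unitVec v
  IAS-S v x rewrite splitAt-↑ʳ n (n + n) (n ↑ʳ v) | splitAt-↑ʳ n n v = refl

fullSet-lookup : ∀ {m} (j : Fin m) → lookup (fullSet {m}) j ≡ true
fullSet-lookup {suc m} zero    = refl
fullSet-lookup {suc m} (suc j) = fullSet-lookup j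

fullSet-card : ∀ m → ∣ fullSet {m} ∣ ≡ m
fullSet-card zero    = refl
fullSet-card (suc m) = cong suc (fullSet-card m)

unitColumns-independent : ∀ n (R : Subset n) → Indep (unitColumns n) R
unitColumns-independent n R u _ (j , uj) lc≗0 =
  t≢f (trans (sym uj) (trans (sym (lc-unitColumns n u j)) (lc≗0 j)))

-- r(M[IAS(G)]) = n: the identity columns are independent and span everything.
rank-IAS : ∀ {n} (G : Graph n) → matroidRank (IAS G) ≡ n
rank-IAS {n} G = ≤-antisym at-most at-least
  where
  everything = lookup (fullSet {n + (n + n)})
  at-most : matroidRank (IAS G) ≤ n
  at-most = subst (matroidRank (IAS G) ≤_) (fullSet-card n)
    (rank-≤-spanner (IAS G) fullSet (unitColumns n) fullSet
      (λ j _ → IAS G j , (λ i _ → fullSet-lookup i) , lc-unitColumns n (IAS G j)))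
  at-least : n ≤ matroidRank (IAS G)
  at-least = subst (_≤ matroidRank (IAS G)) (fullSet-card n)
    (rank-≥-spanned (IAS G) fullSet (unitColumns n) fullSet (unitColumns-independent n fullSet)
      (λ v _ → span-cong (IAS G) everything (IAS-I G v)
                 (span-col (IAS G) everything (copyI v) (fullSet-lookup (copyI v)))))

module _ {n : ℕ} (G : Graph n) where
  adjColumns : Columns n n
  adjColumns = adjCol G

  cutColumns : Subset n → Columns n n
  cutColumns X x v = not (lookup X v) ∧ adj G v x

  lc-cut : ∀ X u x → lc (cutColumns X) u x ≡ not (lookup X x) ∧ lc adjColumns u x
  lc-cut X u x = trans (Σ-cong n (λ v → ∧-left-swap (u v) (not (lookup X x)) (adj G x v))) (Σ-scale n _ _)
    where
    ∧-left-swap : ∀ a b c → a ∧ (b ∧ c) ≡ b ∧ (a ∧ c)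
    ∧-left-swap a b c = trans (sym (∧-assoc a b c)) (trans (cong (_∧ c) (∧-comm a b)) (∧-assoc b a c))

  IA : Columns n (n + n)
  IA i = [ unitVec , adjCol G ]′ (splitAt n i)

  _∥_ : GF2Vec n → GF2Vec n → GF2Vec (n + n)
  (f ∥ g) i = [ f , g ]′ (splitAt n i)

  ∥-left : ∀ f g v → (f ∥ g) (v ↑ˡ n) ≡ f v
  ∥-left f g v rewrite splitAt-↑ˡ n v n = refl

  ∥-right : ∀ f g v → (f ∥ g) (n ↑ʳ v) ≡ g v
  ∥-right f g v rewrite splitAt-↑ʳ n n v = refl

  IA-left : ∀ v → IA (v ↑ˡ n) ≗ unitVec v
  IA-left v x rewrite splitAt-↑ˡ n v n = refl

  IA-right : ∀ v → IA (n ↑ʳ v) ≗ adjCol G v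
  IA-right v x rewrite splitAt-↑ʳ n n v = refl

  lc-IA : ∀ u x → lc IA u x ≡ u (x ↑ˡ n) xor lc adjColumns (λ v → u (n ↑ʳ v)) x
  lc-IA u x = trans (Σ-split n n _) (cong₂ _xor_
    (trans (Σ-cong n (λ v → cong (u (v ↑ˡ n) ∧_) (IA-left v x))) (lc-unitColumns n (λ v → u (v ↑ˡ n)) x))
    (Σ-cong n (λ v → cong (u (n ↑ʳ v) ∧_) (IA-right v x))))

  module _ (X : Subset n) where
    private
      cutBasis = basis (cutColumns X) X
    open Basis cutBasis renaming (set to J; ⊆S to J⊆X; independent to J-independent; size to cutRank≡∣J∣)

    -- e_v (v ∈ X) and a_v (v ∈ J) are independent: a vanishing combination
    -- u₁ + A·u₂ has A·u₂ = 0 off X, so u₂ = 0 by independence of J in the cut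
    -- matrix, and then u₁ = 0.
    IA-independent : Indep IA (X ++ J)
    IA-independent u u⊆X++J (i₀ , ui₀) lc≗0 = nonzero-at i₀ (↑-view n n i₀) ui₀
      where
      u₁ u₂ : GF2Vec n
      u₁ v = u (v ↑ˡ n)
      u₂ v = u (n ↑ʳ v)
      sum≡0 : ∀ x → u₁ x xor lc adjColumns u₂ x ≡ false
      sum≡0 x = trans (sym (lc-IA u x)) (lc≗0 x)
      u₁-off-X : ∀ x → lookup X x ≡ false → u₁ x ≡ false
      u₁-off-X x Xx with u₁ x in u₁x
      ... | false = refl
      ... | true  = ⊥-elim (t≢f (trans (sym (trans (sym (lookup-++ˡ X J x)) (u⊆X++J _ u₁x))) Xx))
      u₂⊆J : u₂ ⊆ᶠ lookup J
      u₂⊆J v e = trans (sym (lookup-++ʳ X J v)) (u⊆X++J _ e)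
      cut≗0 : lc (cutColumns X) u₂ ≗ zeroVec
      cut≗0 x = trans (lc-cut X u₂ x) (guarded-zero (lookup X x) λ Xx →
        trans (cong (_xor lc adjColumns u₂ x) (sym (u₁-off-X x Xx))) (sum≡0 x))
      u₂≡0 : ∀ v → u₂ v ≡ false
      u₂≡0 with zero-or-nonzero u₂
      ... | inj₁ u₂≢0 = ⊥-elim (J-independent u₂ u₂⊆J u₂≢0 cut≗0)
      ... | inj₂ u₂≡0 = u₂≡0
      u₁≡0 : ∀ v → u₁ v ≡ false
      u₁≡0 v = trans (sym (xor-identityʳ (u₁ v)))
                 (trans (cong (u₁ v xor_) (sym (lc-zero adjColumns u₂≡0 v))) (sum≡0 v))
      nonzero-at : ∀ i → (∃[ v ] i ≡ v ↑ˡ n) ⊎ (∃[ v ] i ≡ n ↑ʳ v) → u i ≢ true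
      nonzero-at _ (inj₁ (v , refl)) ui = t≢f (trans (sym ui) (u₁≡0 v))
      nonzero-at _ (inj₂ (v , refl)) ui = t≢f (trans (sym ui) (u₂≡0 v))

    -- For v ∈ X, a_v = Σ_{y ∈ X} (a_v + A·c)_y e_y + A·c where c ⊆ J expresses
    -- the cut column of v: the two sides agree off X by the choice of c, and
    -- on X by construction.
    IA-spans-adj : ∀ v → lookup X v ≡ true → InSpan IA (lookup (X ++ J)) (adjCol G v)
    IA-spans-adj v Xv with basis-spans (cutColumns X) X cutBasis v Xv
    ... | c , c⊆J , lc≗cut = f ∥ c , ⊆X++J , lc≗adj
      where
      f : GF2Vec n
      f x = lookup X x ∧ (adj G x v xor lc adjColumns c x)
      ⊆X++J : (f ∥ c) ⊆ᶠ lookup (X ++ J)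
      ⊆X++J i e with ↑-view n n i
      ... | inj₁ (x , refl) = trans (lookup-++ˡ X J x) (proj₁ (∧-true (trans (sym (∥-left f c x)) e)))
      ... | inj₂ (w , refl) = trans (lookup-++ʳ X J w) (c⊆J w (trans (sym (∥-right f c w)) e))
      on-X : ∀ x b → lookup X x ≡ b → (b ∧ (adj G x v xor lc adjColumns c x)) xor lc adjColumns c x ≡ adj G x v
      on-X x true  _  = solve 2 (λ a l → (a :+ l) :+ l := a) refl (adj G x v) (lc adjColumns c x)
      on-X x false Xx = trans (sym (trans (lc-cut X c x) (cong (λ b → not b ∧ lc adjColumns c x) Xx)))
                              (trans (lc≗cut x) (cong (λ b → not b ∧ adj G x v) Xx))
      lc≗adj : lc IA (f ∥ c) ≗ adjCol G v
      lc≗adj x = begin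
        lc IA (f ∥ c) x
          ≡⟨ lc-IA (f ∥ c) x ⟩
        (f ∥ c) (x ↑ˡ n) xor lc adjColumns (λ w → (f ∥ c) (n ↑ʳ w)) x
          ≡⟨ cong₂ _xor_ (∥-left f c x) (lc-cong adjColumns (∥-right f c) x) ⟩
        f x xor lc adjColumns c x
          ≡⟨ on-X x (lookup X x) refl ⟩
        adj G x v ∎
        where open ≡-Reasoning

    rank-lower : ∀ (S : Subset (n + (n + n))) →
      (∀ v → lookup X v ≡ true → InSpan (IAS G) (lookup S) (unitVec v) × InSpan (IAS G) (lookup S) (adjCol G v)) →
      ∣ X ∣ + cutRank G X ≤ rank (IAS G) S
    rank-lower S spans =
      subst (_≤ rank (IAS G) S) (trans (card-++ X J) (cong (∣ X ∣ +_) (sym cutRank≡∣J∣)))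
        (rank-≥-spanned (IAS G) S IA (X ++ J) IA-independent IA-in-span)
      where
      IA-in-span : ∀ i → lookup (X ++ J) i ≡ true → InSpan (IAS G) (lookup S) (IA i)
      IA-in-span i e with ↑-view n n i
      ... | inj₁ (v , refl) = span-cong (IAS G) _ (λ x → sym (IA-left v x))
                                (proj₁ (spans v (trans (sym (lookup-++ˡ X J v)) e)))
      ... | inj₂ (v , refl) = span-cong (IAS G) _ (λ x → sym (IA-right v x))
                                (proj₂ (spans v (J⊆X v (trans (sym (lookup-++ʳ X J v)) e))))

    -- Upper bound: every column of S_X lies in the span of X ++ J.
    rank-copies-upper : rank (IAS G) (copies X) ≤ ∣ X ∣ + cutRank G X
    rank-copies-upper =
      subst (rank (IAS G) (copies X) ≤_) (trans (card-++ X J) (cong (∣ X ∣ +_) (sym cutRank≡∣J∣)))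
        (rank-≤-spanner (IAS G) (copies X) IA (X ++ J) column-in-span)
      where
      R = lookup (X ++ J)
      unit-in-span : ∀ v → lookup X v ≡ true → InSpan IA R (unitVec v)
      unit-in-span v Xv = span-cong IA R (IA-left v) (span-col IA R (v ↑ˡ n) (trans (lookup-++ˡ X J v) Xv))
      vertex-in-X : ∀ j → lookup (copies X) j ≡ true → lookup X (vertex j) ≡ true
      vertex-in-X j e = trans (sym (lookup∘tabulate _ j)) e
      column-in-span : ∀ j → lookup (copies X) j ≡ true → InSpan IA R (IAS G j)
      column-in-span j e with copy-view {n} j | vertex-in-X j e
      ... | inj₁ (v , refl)        | Xv rewrite vertex-I v =
        span-cong IA R (λ x → sym (IAS-I G v x)) (unit-in-span v Xv)
      ... | inj₂ (inj₁ (v , refl)) | Xv rewrite vertex-A v =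
        span-cong IA R (λ x → sym (IAS-A G v x)) (IA-spans-adj v Xv)
      ... | inj₂ (inj₂ (v , refl)) | Xv rewrite vertex-S v =
        span-cong IA R (λ x → sym (IAS-S G v x)) (span-⊕ IA R (IA-spans-adj v Xv) (unit-in-span v Xv))

    -- Symmetry of cut-rank (rank of the transpose).  Write each cut column
    -- x ∈ X as Σ_{j ∈ J} cf_{x j} (cut column j).  Then the cut columns of
    -- V - X, i.e. the rows of A[V-X, X], are combinations of the |J| vectors
    -- K_j = (cf_{x j})_{x ∈ X}: row y has coefficient A_{y j} on K_j.
    private
      cutCoefficients = choose (cutColumns X) (lookup J) (cutColumns X) (lookup X)
                               (basis-spans (cutColumns X) X cutBasis)
      cf = proj₁ cutCoefficients

      K : Columns n n
      K j x = lookup X x ∧ cf x j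

      rowCoefficients : Fin n → GF2Vec n
      rowCoefficients y j = lookup J j ∧ adj G y j

      row-entry : ∀ y → lookup X y ≡ false → ∀ x → lookup X x ≡ true →
        lc K (rowCoefficients y) x ≡ adj G x y
      row-entry y Xy x Xx = begin
        lc K (rowCoefficients y) x
          ≡⟨ Σ-cong n term ⟩
        Σᵇ n (λ j → cf x j ∧ adj G y j)
          ≡⟨ sym (trans (lc-cut X (cf x) y) (cong (λ b → not b ∧ lc adjColumns (cf x) y) Xy)) ⟩
        lc (cutColumns X) (cf x) y
          ≡⟨ proj₂ (proj₂ cutCoefficients x Xx) y ⟩
        not (lookup X y) ∧ adj G y x
          ≡⟨ cong (λ b → not b ∧ adj G y x) Xy ⟩
        adj G y x
          ≡⟨ Graph.sym G y x ⟩
        adj G x y ∎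
        where
        open ≡-Reasoning
        term : ∀ j → rowCoefficients y j ∧ K j x ≡ cf x j ∧ adj G y j
        term j with cf x j in cfxj
        ... | false = trans (cong (rowCoefficients y j ∧_) (cong (_∧ false) Xx)) (∧-zeroʳ _)
        ... | true  = trans (cong₂ (λ a b → (a ∧ adj G y j) ∧ (b ∧ true))
                                   (proj₁ (proj₂ cutCoefficients x Xx) j cfxj) Xx)
                            (∧-identityʳ _)

      row-in-span : ∀ y → lookup (∁ X) y ≡ true → InSpan K (lookup J) (cutColumns (∁ X) y)
      row-in-span y y∉X =
        rowCoefficients y , (λ j e → proj₁ (∧-true e)) , λ x → by-membership x (lookup X x) refl
        where
        Xy : lookup X y ≡ false
        Xy = trans (sym (not-involutive _)) (cong not (trans (sym (∁-lookup X y)) y∉X))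
        ∁-entry : ∀ x {b} → lookup X x ≡ b → cutColumns (∁ X) y x ≡ b ∧ adj G x y
        ∁-entry x {b} Xx = trans (cong (λ c → not c ∧ adj G x y) (trans (∁-lookup X x) (cong not Xx)))
                                 (cong (_∧ adj G x y) (not-involutive b))
        by-membership : ∀ x b → lookup X x ≡ b → lc K (rowCoefficients y) x ≡ cutColumns (∁ X) y x
        by-membership x true  Xx = trans (row-entry y Xy x Xx) (sym (∁-entry x Xx))
        by-membership x false Xx =
          trans (Σ-zero n (λ j → trans (cong (λ b → rowCoefficients y j ∧ (b ∧ cf x j)) Xx) (∧-zeroʳ _)))
                (sym (∁-entry x Xx))

    cutRank-complement : cutRank G (∁ X) ≤ cutRank G X
    cutRank-complement =
      subst (cutRank G (∁ X) ≤_) (sym cutRank≡∣J∣) (rank-≤-spanner (cutColumns (∁ X)) (∁ X) K J row-in-span)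

-- Majority decoding.  Any two of e_v, a_v, a_v + e_v span the third, so a
-- set containing at least two copies of v spans e_v and a_v.

majority : Bool → Bool → Bool → Bool
majority a b c = (a ∧ b) ∨ ((a ∧ c) ∨ (b ∧ c))

majority-not : ∀ a b c → majority (not a) (not b) (not c) ≡ not (majority a b c)
majority-not true  true  c     = refl
majority-not true  false true  = refl
majority-not true  false false = refl
majority-not false true  true  = refl
majority-not false true  false = refl
majority-not false false c     = refl

module _ {n : ℕ} (G : Graph n) where
  private
    C = IAS G

  decode : Subset (n + (n + n)) → Subset n
  decode S = tabulate (λ v → majority (lookup S (copyI v)) (lookup S (copyA v)) (lookup S (copyS v)))

  module _ (S : Subset (n + (n + n))) (v : Fin n) where
    private
      R = lookup S
      e-direct : R (copyI v) ≡ true → InSpan C R (unitVec v)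
      e-direct sI = span-cong C R (IAS-I G v) (span-col C R (copyI v) sI)
      a-direct : R (copyA v) ≡ true → InSpan C R (adjCol G v)
      a-direct sA = span-cong C R (IAS-A G v) (span-col C R (copyA v) sA)
      s-direct : R (copyS v) ≡ true → InSpan C R (adjCol G v ⊕ unitVec v)
      s-direct sS = span-cong C R (IAS-S G v) (span-col C R (copyS v) sS)
      cancelʳ : ∀ a e → (a xor e) xor e ≡ a
      cancelʳ = solve 2 (λ a e → (a :+ e) :+ e := a) refl
      cancelˡ : ∀ a e → (a xor e) xor a ≡ e
      cancelˡ = solve 2 (λ a e → (a :+ e) :+ a := e) refl

    majority-spans : majority (R (copyI v)) (R (copyA v)) (R (copyS v)) ≡ true →
      InSpan C R (unitVec v) × InSpan C R (adjCol G v)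
    majority-spans maj with R (copyI v) in sI | R (copyA v) in sA | R (copyS v) in sS
    ... | true  | true  | _     = e-direct sI , a-direct sA
    ... | true  | false | true  =
      e-direct sI , span-cong C R (λ x → cancelʳ (adjCol G v x) _) (span-⊕ C R (s-direct sS) (e-direct sI))
    ... | false | true  | true  =
      span-cong C R (λ x → cancelˡ (adjCol G v x) _) (span-⊕ C R (s-direct sS) (a-direct sA)) , a-direct sA
    ... | true  | false | false = ⊥-elim (t≢f (sym maj))
    ... | false | true  | false = ⊥-elim (t≢f (sym maj))
    ... | false | false | _     = ⊥-elim (t≢f (sym maj))

  -- majority commutes with complementation, so E - S decodes to V - X
  decode-∁ : ∀ S v → lookup (∁ (decode S)) v ≡ true →
    majority (lookup (∁ S) (copyI v)) (lookup (∁ S) (copyA v)) (lookup (∁ S) (copyS v)) ≡ true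
  decode-∁ S v e = begin
    majority (lookup (∁ S) (copyI v)) (lookup (∁ S) (copyA v)) (lookup (∁ S) (copyS v))
      ≡⟨ cong₂ (λ a (bc : Bool × Bool) → majority a (proj₁ bc) (proj₂ bc)) (∁-lookup S _)
           (cong₂ _,_ (∁-lookup S _) (∁-lookup S _)) ⟩
    majority (not (lookup S (copyI v))) (not (lookup S (copyA v))) (not (lookup S (copyS v)))
      ≡⟨ majority-not (lookup S (copyI v)) (lookup S (copyA v)) (lookup S (copyS v)) ⟩
    not (majority (lookup S (copyI v)) (lookup S (copyA v)) (lookup S (copyS v)))
      ≡⟨ cong not (sym (lookup∘tabulate _ v)) ⟩
    not (lookup (decode S) v)
      ≡⟨ sym (∁-lookup (decode S) v) ⟩
    lookup (∁ (decode S)) v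
      ≡⟨ e ⟩
    true ∎
    where open ≡-Reasoning

  rank-decode : ∀ S → ∣ decode S ∣ + cutRank G (decode S) ≤ rank C S
  rank-decode S = rank-lower G (decode S) S
    (λ v e → majority-spans S v (trans (sym (lookup∘tabulate _ v)) e))

  rank-decode-∁ : ∀ S → ∣ ∁ (decode S) ∣ + cutRank G (∁ (decode S)) ≤ rank C (∁ S)
  rank-decode-∁ S = rank-lower G (∁ (decode S)) (∁ S) (λ v e → majority-spans (∁ S) v (decode-∁ S v e))

  rank-copies : ∀ X → rank C (copies X) ≡ ∣ X ∣ + cutRank G X
  rank-copies X = ≤-antisym (rank-copies-upper G X) (rank-lower G X (copies X) all-copies)
    where
    all-copies : ∀ v → lookup X v ≡ true →
      InSpan C (lookup (copies X)) (unitVec v) × InSpan C (lookup (copies X)) (adjCol G v)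
    all-copies v Xv = majority-spans (copies X) v all-in
      where
      in-copies : ∀ j → vertex j ≡ v → lookup (copies X) j ≡ true
      in-copies j e = trans (lookup∘tabulate _ j) (trans (cong (lookup X) e) Xv)
      all-in : majority (lookup (copies X) (copyI v)) (lookup (copies X) (copyA v))
                        (lookup (copies X) (copyS v)) ≡ true
      all-in rewrite in-copies (copyI v) (vertex-I v) | in-copies (copyA v) (vertex-A v) = refl

  ∁-copies : ∀ X → ∁ (copies X) ≡ copies (∁ X)
  ∁-copies X = trans (sym (tabulate-∘ not (lookup X ∘ vertex {n})))
                     (tabulate-cong (λ j → sym (∁-lookup X (vertex j))))

  cutRank-∁ : ∀ X → cutRank G (∁ X) ≡ cutRank G X
  cutRank-∁ X = ≤-antisym (cutRank-complement G X)
    (subst (λ Y → cutRank G Y ≤ cutRank G (∁ X)) (∁-involutive X) (cutRank-complement G (∁ X)))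

record VerticalSep {n m} (C : Columns n m) (k : ℕ) (S : Subset m) : Set where
  field
    λ<k   : connectivity C S < k
    k≤r   : k ≤ rank C S
    k≤r∁ : k ≤ rank C (∁ S)

verticalSepᵇ-sound : ∀ {n m} (C : Columns n m) k S → verticalSepᵇ C k S ≡ true → VerticalSep C k S
verticalSepᵇ-sound C k S e = record
  { λ<k  = <ᵇ⇒< _ _ (Equivalence.from T-≡ λ<kᵇ)
  ; k≤r  = ≤ᵇ⇒≤ _ _ (Equivalence.from T-≡ (proj₁ (∧-true ranksᵇ)))
  ; k≤r∁ = ≤ᵇ⇒≤ _ _ (Equivalence.from T-≡ (proj₂ (∧-true {k ≤ᵇ rank C S} ranksᵇ))) }
  where
  λ<kᵇ = proj₁ (∧-true e)
  ranksᵇ = proj₂ (∧-true {connectivity C S <ᵇ k} e)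

verticalSepᵇ-complete : ∀ {n m} (C : Columns n m) k S → VerticalSep C k S → verticalSepᵇ C k S ≡ true
verticalSepᵇ-complete C k S sep
  rewrite Equivalence.to T-≡ (<⇒<ᵇ (VerticalSep.λ<k sep))
        | Equivalence.to T-≡ (≤⇒≤ᵇ (VerticalSep.k≤r sep))
        | Equivalence.to T-≡ (≤⇒≤ᵇ (VerticalSep.k≤r∁ sep)) = refl

kappa-≤ : ∀ {n m} (C : Columns n m) k S → VerticalSep C k S → k ≤ matroidRank C → kappa C ≤ k
kappa-≤ C k S sep k≤r =
  minOver-lower (hasVerticalSepᵇ C) (matroidRank C) (upTo (suc (matroidRank C))) (∈-upTo⁺ (s≤s k≤r))
    (any-intro (verticalSepᵇ C k) (∈-allSubsets S) (verticalSepᵇ-complete C k S sep))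

kappa-≥ : ∀ {n m} (C : Columns n m) b →
  b ≤ matroidRank C → (∀ k S → VerticalSep C k S → b ≤ k) → b ≤ kappa C
kappa-≥ {m = m} C b b≤r bounds with minOver-attained (hasVerticalSepᵇ C) (matroidRank C) (upTo (suc (matroidRank C)))
... | inj₁ κ≡r = subst (b ≤_) (sym κ≡r) b≤r
... | inj₂ (k , has-k , κ≡k) with any-elim (verticalSepᵇ C k) (allSubsets m) has-k
...   | S , sepᵇ = subst (b ≤_) (sym κ≡k) (bounds k S (verticalSepᵇ-sound C k S sepᵇ))

kappa-no-separation : ∀ {n m} (C : Columns n m) → (∀ k S → ¬ VerticalSep C k S) → kappa C ≡ matroidRank C
kappa-no-separation C none =
  ≤-antisym (minOver-≤-default (hasVerticalSepᵇ C) (matroidRank C) (upTo (suc (matroidRank C))))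
            (kappa-≥ C _ ≤-refl (λ k S sep → ⊥-elim (none k S sep)))

twice : ∀ c → 2 * c ≡ c + c
twice c = cong (c +_) (+-identityʳ c)

connectivity-arith : ∀ n x y c → x + y ≡ n → ((x + c) + (y + c)) ∸ n ≡ c + c
connectivity-arith n x y c x+y≡n =
  trans (cong (_∸ n) (trans (rearrange x c y c) (cong ((c + c) +_) x+y≡n))) (m+n∸n≡m (c + c) n)
  where
  rearrange : ∀ x c y c′ → (x + c) + (y + c′) ≡ (c + c′) + (x + y)
  rearrange = solve-∀

small-side : ∀ {n a b k} → (a + b) ∸ n < k → k ≤ b → a < n
small-side {n} {a} {b} λ<k k≤b with n ≤? a
... | no  a≱n = ≰⇒> a≱n
... | yes n≤a = ⊥-elim (<-irrefl refl (<-≤-trans (≤-<-trans b≤λ λ<k) k≤b))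
  where
  b≤λ : b ≤ (a + b) ∸ n
  b≤λ = subst (b ≤_) (sym (+-∸-comm b n≤a)) (m≤n+m b (a ∸ n))

separation-arith : ∀ {n a b x y c k} → x + y ≡ n → x + c ≤ a → y + c ≤ b →
  (a + b) ∸ n < k → k ≤ a → k ≤ b → c < x × c < y × c + c < k
separation-arith {n} {a} {b} {x} {y} {c} {k} x+y≡n x+c≤a y+c≤b λ<k k≤a k≤b =
  +-cancelˡ-< y c x (<-≤-trans (≤-<-trans y+c≤b b<n) (≤-reflexive (trans (sym x+y≡n) (+-comm x y)))) ,
  +-cancelˡ-< x c y (<-≤-trans (≤-<-trans x+c≤a a<n) (≤-reflexive (sym x+y≡n))) ,
  ≤-<-trans (subst (_≤ (a + b) ∸ n) (connectivity-arith n x y c x+y≡n)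
                   (∸-monoˡ-≤ n (+-mono-≤ x+c≤a y+c≤b))) λ<k
  where
  a<n : a < n
  a<n = small-side λ<k k≤b
  b<n : b < n
  b<n = small-side (subst (λ s → s ∸ n < k) (+-comm a b) λ<k) k≤a

1+2c≤x+c : ∀ {x c} → c < x → 1 + 2 * c ≤ x + c
1+2c≤x+c {x} {c} c<x = subst (λ s → suc s ≤ x + c) (sym (twice c)) (+-monoˡ-≤ c c<x)

Deficient : ∀ {n} → Graph n → Subset n → Set
Deficient G X = cutRank G X < ∣ X ∣ ⊓ ∣ ∁ X ∣

module _ {n : ℕ} (G : Graph n) where
  private
    C = IAS G

  separation-cut : ∀ {k S} → VerticalSep C k S →
    Deficient G (decode G S) × cutRank G (decode G S) + cutRank G (decode G S) < k
  separation-cut {k} {S} sep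
    with separation-arith (card-∁ X) (rank-decode G S) other-side λ<n (VerticalSep.k≤r sep) (VerticalSep.k≤r∁ sep)
    where
    X = decode G S
    other-side : ∣ ∁ X ∣ + cutRank G X ≤ rank C (∁ S)
    other-side = subst (λ c → ∣ ∁ X ∣ + c ≤ rank C (∁ S)) (cutRank-∁ G X) (rank-decode-∁ G S)
    λ<n : (rank C S + rank C (∁ S)) ∸ n < k
    λ<n = subst (λ r → (rank C S + rank C (∁ S)) ∸ r < k) (rank-IAS G) (VerticalSep.λ<k sep)
  ... | c<x , c<y , 2c<k = ⊓-pres-m< c<x c<y , 2c<k

  copies-separation : ∀ X → Deficient G X → VerticalSep C (1 + 2 * cutRank G X) (copies X)
  copies-separation X c<min = record
    { λ<k  = subst (_< 1 + 2 * c) (sym λ≡2c) (subst (λ s → s < suc (2 * c)) (twice c) (n<1+n (2 * c)))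
    ; k≤r  = subst (1 + 2 * c ≤_) (sym r-side) (1+2c≤x+c c<x)
    ; k≤r∁ = subst (1 + 2 * c ≤_) (sym r-other) (1+2c≤x+c c<y) }
    where
    c = cutRank G X
    c<x = m<n⊓o⇒m<n ∣ X ∣ ∣ ∁ X ∣ c<min
    c<y = m<n⊓o⇒m<o ∣ X ∣ ∣ ∁ X ∣ c<min
    r-side : rank C (copies X) ≡ ∣ X ∣ + c
    r-side = rank-copies G X
    r-other : rank C (∁ (copies X)) ≡ ∣ ∁ X ∣ + c
    r-other = trans (cong (rank C) (∁-copies G X))
                    (trans (rank-copies G (∁ X)) (cong (∣ ∁ X ∣ +_) (cutRank-∁ G X)))
    λ≡2c : connectivity C (copies X) ≡ c + c
    λ≡2c = trans (cong₂ (λ a b → (a + b) ∸ matroidRank C) r-side r-other)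
                 (trans (cong (((∣ X ∣ + c) + (∣ ∁ X ∣ + c)) ∸_) (rank-IAS G))
                        (connectivity-arith n ∣ X ∣ ∣ ∁ X ∣ c (card-∁ X)))

  separation-order-≤-rank : ∀ X → Deficient G X → 1 + 2 * cutRank G X ≤ matroidRank C
  separation-order-≤-rank X c<min = subst (1 + 2 * cutRank G X ≤_) (sym (rank-IAS G))
    (≤-trans (1+2c≤x+c (m<n⊓o⇒m<n ∣ X ∣ ∣ ∁ X ∣ c<min))
      (≤-trans (+-monoʳ-≤ ∣ X ∣ (<⇒≤ (m<n⊓o⇒m<o ∣ X ∣ ∣ ∁ X ∣ c<min)))
               (≤-reflexive (card-∁ X))))

corollary18 : ∀ (n : ℕ) (G : Graph n) →
    ((∀ (X : Subset n) → cutRank G X ≡ ∣ X ∣ ⊓ ∣ ∁ X ∣) → kappa (IAS G) ≡ n)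
    × (∀ (c : ℕ) →
         (∃[ X ] (cutRank G X < ∣ X ∣ ⊓ ∣ ∁ X ∣ × cutRank G X ≡ c)) →
         (∀ (Y : Subset n) → cutRank G Y < ∣ Y ∣ ⊓ ∣ ∁ Y ∣ → c ≤ cutRank G Y) →
         kappa (IAS G) ≡ 1 + 2 * c)
corollary18 n G = no-deficient-cut , minimal-deficient-cut
  where
  -- every vertical separation would exhibit a deficient cut
  no-deficient-cut : (∀ X → cutRank G X ≡ ∣ X ∣ ⊓ ∣ ∁ X ∣) → kappa (IAS G) ≡ n
  no-deficient-cut full = trans (kappa-no-separation (IAS G) no-separation) (rank-IAS G)
    where
    no-separation : ∀ k S → ¬ VerticalSep (IAS G) k S
    no-separation k S sep = <-irrefl (full (decode G S)) (proj₁ (separation-cut G sep))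

  -- S_X₀ is a separation of order 1 + 2c, and any separation has order > 2c
  minimal-deficient-cut : ∀ c → ∃[ X ] (Deficient G X × cutRank G X ≡ c) →
    (∀ Y → Deficient G Y → c ≤ cutRank G Y) → kappa (IAS G) ≡ 1 + 2 * c
  minimal-deficient-cut c (X₀ , deficient , refl) minimal = ≤-antisym
    (kappa-≤ (IAS G) _ (copies X₀) (copies-separation G X₀ deficient) (separation-order-≤-rank G X₀ deficient))
    (kappa-≥ (IAS G) _ (separation-order-≤-rank G X₀ deficient) order-bound)
    where
    order-bound : ∀ k S → VerticalSep (IAS G) k S → 1 + 2 * c ≤ k
    order-bound k S sep with separation-cut G sep
    ... | deficient′ , 2c′<k = subst (λ s → suc s ≤ k) (sym (twice c))
            (≤-<-trans (+-mono-≤ c≤c′ c≤c′) 2c′<k)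
      where c≤c′ = minimal (decode G S) deficient′
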